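{- Let $\mathbb{G}$ be a unicellular fatgraph, $r_1,r_2$ two ribbons, and $\tilde{\mathbb{G}}$ obtained by an $i,j$-reversal ($i<_\gamma j$). Then the reversal changes the crossing status of $r_1,r_2$ (crossing in $\mathbb{G}$ versus crossing in $\tilde{\mathbb{G}}$) if and only if both $r_1$ and $r_2$ intersect $[i,j]_\gamma$.
   Context: A unicellular fatgraph with $n$ ribbons is $\mathbb{G}=([2n+1],\sigma,\gamma,\omega)$ with sectors $[2n+1]$, vertex permutation $\sigma$, boundary cycle $\gamma=(1,\dots,2n+1)$, orientations $\omega:[2n+1]\to\{\pm1\}$, and sectors grouped into ribbons (each ribbon is two pairs $((x,\sigma(x)),(y,\sigma(y)))$ matched along $\gamma$ as in the standard definition of fatgraphs). $<_\gamma$ is the order $1<\dots<2n+1$ along the boundary and $[i,j]_\gamma=\{s:i\le_\gamma s\le_\gamma j\}$. For a ribbon $r$, $r^L,r^R$ are the $<_\gamma$-min and max of its four sectors. $r_1,r_2$ cross if $r_1^L<_\gamma r_2^L<_\gamma r_1^R<_\gamma r_2^R$ or $r_2^L<_\gamma r_1^L<_\gamma r_2^R<_\gamma r_1^R$ (with respect to the boundary order of the fatgraph under consideration). A ribbon $r$ intersects $[i,j]_\gamma$ if $r^L<_\gamma i<_\gamma r^R\le_\gamma j$ or $i\le_\gamma r^L<_\gamma j<_\gamma r^R$. An $i,j$-reversal is one of: gluing (distinct vertices $(i,i_1,\dots,i_p),(j,j_1,\dots,j_q)$ with, after flipping, $\omega(i)=-\omega(j)$, replaced by $(i,j_1,\dots,j_q,j,i_1,\dots,i_p)$);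 slicing (vertex $(i,j_1,\dots,j_q,j,i_1,\dots,i_p)$ with $\omega(i)=-\omega(j)$ replaced by $(i,i_1,\dots,i_p)$ and $(j,j_1,\dots,j_q)$); half-flipping (same vertex with $\omega(i)=\omega(j)$ replaced by $(i,j_q,\dots,j_1,j,i_1,\dots,i_p)$). Here flipping a vertex reverses the cyclic order of its sectors and changes their orientations. The resulting $\tilde{\mathbb{G}}$ is unicellular with boundary cycle $(1,\dots,i,j-1,\dots,i+1,j,\dots,2n+1)$, and ribbons of $\mathbb{G}$ and $\tilde{\mathbb{G}}$ are identified via the natural bijection induced by the reversal. -}

module Defs where

open import Data.Nat using (ℕ; zero; suc; pred; _+_; _*_; _∸_; _<_; _≤_; _⊓_; _⊔_; _≡ᵇ_; _≤ᵇ_)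
open import Data.Fin using (Fin; toℕ)
open import Data.Bool using (Bool; true; false; if_then_else_; _∨_)
open import Data.Product using (_×_; _,_; proj₁; proj₂)
open import Data.Sum using (_⊎_)
open import Function.Definitions using (Injective)
open import Relation.Binary.PropositionalEquality using (_≡_)

-- Sectors of a unicellular fatgraph with n ribbons: Fin (suc (2 * n));
-- the label k stands for the paper's sector k+1, so the boundary cycle
-- γ = (1,…,2n+1) lists the labels 0,1,…,2n and <_γ is the order of ℕ
-- on labels.
-- Boundary steps: step k (k < 2n) is the ribbon side traversed by γ from
-- sector k to sector k+1.  Each ribbon has exactly two sides, i.e. two
-- steps, and every step is a side of exactly one ribbon.

Sector : ℕ → Set
Sector n = Fin (suc (2 * n))

record UFatgraph (n : ℕ) : Set where
  field
    side     : Fin n × Fin 2 → Fin (2 * n)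
    -- distinct sides are distinct steps (hence a bijection, by counting)
    side-inj : Injective _≡_ _≡_ side

open UFatgraph public

stepSectors : ℕ → ℕ × ℕ
stepSectors k = k , suc k

-- the two sectors joined (along the new boundary) by the ribbon side that
-- was step k of 𝔾, after the i,j-reversal (natural bijection):
-- the side i→i+1 now joins i+1 and j, the side j-1→j now joins i and j-1,
-- all other sides keep their two sectors.
revStepSectors : ℕ → ℕ → ℕ → ℕ × ℕ
revStepSectors i j k =
  if k ≡ᵇ i then (suc i , j)
  else if suc k ≡ᵇ j then (i , pred j)
  else (k , suc k)

-- position of sector s along the boundary cycle
-- (1,…,i,j-1,…,i+1,j,…,2n+1) of the reversed fatgraph 𝔾̃
revPos : ℕ → ℕ → ℕ → ℕ
revPos i j s = if (s ≤ᵇ i) ∨ (j ≤ᵇ s) then s else (i + j) ∸ s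

quad : ∀ {n} → UFatgraph n → (ℕ → ℕ × ℕ) → Fin n → (ℕ × ℕ) × (ℕ × ℕ)
quad G f r = f (toℕ (side G (r , Fin.zero))) , f (toℕ (side G (r , Fin.suc Fin.zero)))
  where import Data.Fin as Fin

-- r^L and r^R: <-minimum and maximum of the four sectors, measured by
-- the position function pos of the boundary order under consideration
ends : (ℕ → ℕ) → (ℕ × ℕ) × (ℕ × ℕ) → ℕ × ℕ
ends pos ((a , b) , (c , d)) =
  ((pos a ⊓ pos b) ⊓ (pos c ⊓ pos d)) , ((pos a ⊔ pos b) ⊔ (pos c ⊔ pos d))

Crosses : ℕ × ℕ → ℕ × ℕ → Set
Crosses (l₁ , r₁) (l₂ , r₂) =
  (l₁ < l₂ × l₂ < r₁ × r₁ < r₂) ⊎ (l₂ < l₁ × l₁ < r₂ × r₂ < r₁)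

Intersects : ℕ × ℕ → ℕ → ℕ → Set
Intersects (L , R) i j = (L < i × i < R × R ≤ j) ⊎ (i ≤ L × L < j × j < R)

endsG : ∀ {n} → UFatgraph n → Fin n → ℕ × ℕ
endsG G r = ends (λ s → s) (quad G stepSectors r)

endsRev : ∀ {n} → UFatgraph n → ℕ → ℕ → Fin n → ℕ × ℕ
endsRev G i j r = ends (revPos i j) (quad G (revStepSectors i j) r)

-- Describe a ribbon by the two boundary steps a, b occupied by its sides (step k joins sectors k
-- and k+1); its ends are then a ⊓ b and suc (a ⊔ b). Two ribbons with sides {a, b} and {c, d}
-- cross iff an odd number of the four pairs (x, y) ∈ {a, b} × {c, d} satisfy x < y. The
-- i,j-reversal reverses the block of steps i, …, j-1 and fixes all other steps, so it flips
-- exactly those comparisons whose two steps both lie in the block. The crossing parity therefore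
-- changes by (number of sides of r₁ in the block) · (number of sides of r₂ in the block) mod 2,
-- while a ribbon intersects [i, j] iff exactly one of its sides lies in the block.
module Submission where

open import Defs
open import Data.Nat
  using (ℕ; zero; suc; _<_; _≤_; z≤n; s≤s; s≤s⁻¹; _+_; _∸_; _⊓_; _⊔_; _<ᵇ_; _≤ᵇ_; _≡ᵇ_)
open import Data.Nat.Properties
open import Data.Fin using (Fin; toℕ)
open import Data.Fin.Patterns using (0F; 1F)
open import Data.Fin.Properties using (toℕ-injective)
open import Data.Bool using (Bool; true; false; not; _∧_; _xor_; T)
open import Data.Bool.Properties using (xor-comm; xor-∧-commutativeRing; T-∧; ∨-zeroʳ)
open import Data.Maybe using (nothing)
open import Data.Product using (_×_; _,_; proj₁)
open import Data.Product.Function.NonDependent.Propositional using (_×-⇔_)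
open import Data.Sum using (_⊎_; inj₁; inj₂; [_,_])
open import Data.Unit using (tt)
open import Function using (_∘_; const)
open import Function.Bundles using (_⇔_; mk⇔; Equivalence)
open import Function.Construct.Composition using (_⇔-∘_)
open import Function.Construct.Symmetry using (⇔-sym)
import Function.Related.Propositional as Related
open import Relation.Binary.Definitions using (tri<; tri≈; tri>)
open import Relation.Binary.PropositionalEquality
  using (_≡_; _≢_; refl; sym; trans; cong; cong₂; subst; subst₂; ≢-sym; module ≡-Reasoning)
open import Relation.Nullary using (¬_; yes; no; contradiction)
open import Relation.Nullary.Decidable using (dec-true; dec-false)
open import Tactic.RingSolver using (solve-∀)
open import Tactic.RingSolver.Core.AlmostCommutativeRing
  using (AlmostCommutativeRing; fromCommutativeRing)

open Equivalence using (to; from)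

<ᵇ-true : ∀ {m n} → m < n → (m <ᵇ n) ≡ true
<ᵇ-true {m} {n} = dec-true (m <? n)

<ᵇ-false : ∀ {m n} → n ≤ m → (m <ᵇ n) ≡ false
<ᵇ-false {m} {n} = dec-false (m <? n) ∘ ≤⇒≯

≤ᵇ-true : ∀ {m n} → m ≤ n → (m ≤ᵇ n) ≡ true
≤ᵇ-true {m} {n} = dec-true (m ≤? n)

≤ᵇ-false : ∀ {m n} → n < m → (m ≤ᵇ n) ≡ false
≤ᵇ-false {m} {n} = dec-false (m ≤? n) ∘ <⇒≱

≡ᵇ-refl : ∀ m → (m ≡ᵇ m) ≡ true
≡ᵇ-refl m = dec-true (m ≟ m) refl

≡ᵇ-false : ∀ {m n} → m ≢ n → (m ≡ᵇ n) ≡ false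
≡ᵇ-false {m} {n} = dec-false (m ≟ n)

<ᵇ-both : ∀ {m n m′ n′} → m < n → m′ < n′ → (m <ᵇ n) ≡ (m′ <ᵇ n′)
<ᵇ-both m<n m′<n′ = trans (<ᵇ-true m<n) (sym (<ᵇ-true m′<n′))

<ᵇ-neither : ∀ {m n m′ n′} → n ≤ m → n′ ≤ m′ → (m <ᵇ n) ≡ (m′ <ᵇ n′)
<ᵇ-neither n≤m n′≤m′ = trans (<ᵇ-false n≤m) (sym (<ᵇ-false n′≤m′))

m∸n≡suc[m∸[1+n]] : ∀ {m n} → n < m → m ∸ n ≡ suc (m ∸ suc n)
m∸n≡suc[m∸[1+n]] {suc m} {zero}  _         = refl
m∸n≡suc[m∸[1+n]] {suc m} {suc n} (s≤s n<m) = m∸n≡suc[m∸[1+n]] n<m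

-- Chords and their crossing parity

chord : ℕ → ℕ → ℕ × ℕ
chord a b = a ⊓ b , suc (a ⊔ b)

chord-comm : ∀ a b → chord a b ≡ chord b a
chord-comm a b = cong₂ _,_ (⊓-comm a b) (cong suc (⊔-comm a b))

chord-≤ : ∀ {a b} → a ≤ b → chord a b ≡ (a , suc b)
chord-≤ a≤b = cong₂ _,_ (m≤n⇒m⊓n≡m a≤b) (cong suc (m≤n⇒m⊔n≡n a≤b))

crossParity : ℕ → ℕ → ℕ → ℕ → Bool
crossParity a b c d = ((a <ᵇ c) xor (b <ᵇ c)) xor ((a <ᵇ d) xor (b <ᵇ d))

crossParity-swapˡ : ∀ a b c d → crossParity a b c d ≡ crossParity b a c d
crossParity-swapˡ a b c d = cong₂ _xor_ (xor-comm (a <ᵇ c) _) (xor-comm (a <ᵇ d) _)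

crossParity-swapʳ : ∀ a b c d → crossParity a b c d ≡ crossParity a b d c
crossParity-swapʳ a b c d = xor-comm ((a <ᵇ c) xor (b <ᵇ c)) _

Crosses-sorted-< : ∀ {a b c d} → c < d → a < c → b ≢ c → b ≢ d →
                   Crosses (a , suc b) (c , suc d) ⇔ T (crossParity a b c d)
Crosses-sorted-< {a} {b} {c} {d} c<d a<c b≢c b≢d
  rewrite <ᵇ-true a<c | <ᵇ-true (<-trans a<c c<d) with <-cmp b c
... | tri≈ _ b≡c _ = contradiction b≡c b≢c
... | tri< b<c _ _ rewrite <ᵇ-true b<c | <ᵇ-true (<-trans b<c c<d) =
  mk⇔ (λ { (inj₁ (_ , c≤b , _)) → <⇒≱ b<c (s≤s⁻¹ c≤b)
         ; (inj₂ (c<a , _))     → <-asym a<c c<a })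
      λ ()
... | tri> _ _ c<b rewrite <ᵇ-false (<⇒≤ c<b) with <-cmp b d
...   | tri≈ _ b≡d _ = contradiction b≡d b≢d
...   | tri< b<d _ _ rewrite <ᵇ-true b<d =
  mk⇔ (const tt) (const (inj₁ (a<c , s≤s (<⇒≤ c<b) , s≤s b<d)))
...   | tri> _ _ d<b rewrite <ᵇ-false (<⇒≤ d<b) =
  mk⇔ (λ { (inj₁ (_ , _ , b<d)) → <-asym d<b (s≤s⁻¹ b<d)
         ; (inj₂ (c<a , _))     → <-asym a<c c<a })
      λ ()

Crosses-sorted-> : ∀ {a b c d} → a < b → c < a → a ≢ d → b ≢ d →
                   Crosses (a , suc b) (c , suc d) ⇔ T (crossParity a b c d)
Crosses-sorted-> {a} {b} {c} {d} a<b c<a a≢d b≢d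
  rewrite <ᵇ-false (<⇒≤ c<a) | <ᵇ-false (<⇒≤ (<-trans c<a a<b)) with <-cmp a d
... | tri≈ _ a≡d _ = contradiction a≡d a≢d
... | tri> _ _ d<a rewrite <ᵇ-false (<⇒≤ d<a) | <ᵇ-false (<⇒≤ (<-trans d<a a<b)) =
  mk⇔ (λ { (inj₁ (a<c , _))     → <-asym a<c c<a
         ; (inj₂ (_ , a≤d , _)) → <⇒≱ d<a (s≤s⁻¹ a≤d) })
      λ ()
... | tri< a<d _ _ rewrite <ᵇ-true a<d with <-cmp b d
...   | tri≈ _ b≡d _ = contradiction b≡d b≢d
...   | tri< b<d _ _ rewrite <ᵇ-true b<d =
  mk⇔ (λ { (inj₁ (a<c , _))     → <-asym a<c c<a
         ; (inj₂ (_ , _ , d<b)) → <-asym b<d (s≤s⁻¹ d<b) })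
      λ ()
...   | tri> _ _ d<b rewrite <ᵇ-false (<⇒≤ d<b) =
  mk⇔ (const tt) (const (inj₂ (c<a , s≤s (<⇒≤ a<d) , s≤s d<b)))

CrossesByParity : ℕ → ℕ → ℕ → ℕ → Set
CrossesByParity a b c d = Crosses (chord a b) (chord c d) ⇔ T (crossParity a b c d)

CrossesByParity-swapˡ : ∀ {a b c d} → CrossesByParity b a c d → CrossesByParity a b c d
CrossesByParity-swapˡ {a} {b} {c} {d} =
  subst₂ (λ x p → Crosses x (chord c d) ⇔ T p) (chord-comm b a) (sym (crossParity-swapˡ a b c d))

CrossesByParity-swapʳ : ∀ {a b c d} → CrossesByParity a b d c → CrossesByParity a b c d
CrossesByParity-swapʳ {a} {b} {c} {d} =
  subst₂ (λ y p → Crosses (chord a b) y ⇔ T p) (chord-comm d c) (sym (crossParity-swapʳ a b c d))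

crossesByParity-sorted : ∀ {a b c d} → a < b → c < d → a ≢ c → a ≢ d → b ≢ c → b ≢ d →
                         CrossesByParity a b c d
crossesByParity-sorted {a} {b} {c} {d} a<b c<d a≢c a≢d b≢c b≢d =
  subst₂ (λ x y → Crosses x y ⇔ T (crossParity a b c d))
         (sym (chord-≤ (<⇒≤ a<b))) (sym (chord-≤ (<⇒≤ c<d))) sorted
  where
  sorted : Crosses (a , suc b) (c , suc d) ⇔ T (crossParity a b c d)
  sorted with <-cmp a c
  ... | tri< a<c _ _ = Crosses-sorted-< c<d a<c b≢c b≢d
  ... | tri≈ _ a≡c _ = contradiction a≡c a≢c
  ... | tri> _ _ c<a = Crosses-sorted-> a<b c<a a≢d b≢d

crossesByParity : ∀ {a b c d} → a ≢ b → c ≢ d → a ≢ c → a ≢ d → b ≢ c → b ≢ d →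
                  CrossesByParity a b c d
crossesByParity {a} {b} {c} {d} a≢b c≢d a≢c a≢d b≢c b≢d with <-cmp a b | <-cmp c d
... | tri≈ _ a≡b _ | _            = contradiction a≡b a≢b
... | _            | tri≈ _ c≡d _ = contradiction c≡d c≢d
... | tri< a<b _ _ | tri< c<d _ _ = crossesByParity-sorted a<b c<d a≢c a≢d b≢c b≢d
... | tri< a<b _ _ | tri> _ _ d<c =
  CrossesByParity-swapʳ (crossesByParity-sorted a<b d<c a≢d a≢c b≢d b≢c)
... | tri> _ _ b<a | tri< c<d _ _ =
  CrossesByParity-swapˡ (crossesByParity-sorted b<a c<d b≢c b≢d a≢c a≢d)
... | tri> _ _ b<a | tri> _ _ d<c =
  CrossesByParity-swapˡ (CrossesByParity-swapʳ (crossesByParity-sorted b<a d<c b≢d b≢c a≢d a≢c))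

-- Reversing the block of steps i, …, j-1

data Position (i j k : ℕ) : Set where
  before : k < i → Position i j k
  inside : i ≤ k → k < j → Position i j k
  after  : i ≤ k → j ≤ k → Position i j k

position : ∀ i j k → Position i j k
position i j k with k <? i | k <? j
... | yes k<i | _       = before k<i
... | no  k≮i | yes k<j = inside (≮⇒≥ k≮i) k<j
... | no  k≮i | no  k≮j = after (≮⇒≥ k≮i) (≮⇒≥ k≮j)

inBlock : ℕ → ℕ → ℕ → Bool
inBlock i j k with position i j k
... | inside _ _ = true
... | _          = false

mirror : ℕ → ℕ → ℕ → ℕ
mirror i j k = i + j ∸ suc k

reverseBlock : ℕ → ℕ → ℕ → ℕ
reverseBlock i j k with position i j k
... | inside _ _ = mirror i j k
... | _          = k

mirror-≥ : ∀ {i j k} → k < j → i ≤ mirror i j k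
mirror-≥ {i} {j} k<j = ≤-trans (≤-reflexive (sym (m+n∸n≡m i j))) (∸-monoʳ-≤ (i + j) k<j)

mirror-< : ∀ {i j k} → i ≤ k → k < j → mirror i j k < j
mirror-< {i} {j} i≤k k<j =
  subst (mirror i j _ <_) (m+n∸m≡n i j) (∸-monoʳ-< (s≤s i≤k) (≤-trans k<j (m≤n+m j i)))

mirror-reverses : ∀ {i j p q} → p < q → q < j → mirror i j q < mirror i j p
mirror-reverses {i} {j} p<q q<j = ∸-monoʳ-< (s≤s p<q) (≤-trans q<j (m≤n+m j i))

mirror-involutive : ∀ {i j k} → k < j → mirror i j (mirror i j k) ≡ k
mirror-involutive {i} {j} {k} k<j = begin
  m ∸ suc t         ≡⟨ cong (_∸ suc t) (sym (m+[n∸m]≡n k<m)) ⟩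
  suc k + t ∸ suc t ≡⟨ cong (_∸ suc t) (sym (+-suc k t)) ⟩
  k + suc t ∸ suc t ≡⟨ m+n∸n≡m k (suc t) ⟩
  k                 ∎
  where
  open ≡-Reasoning
  m t : ℕ
  m = i + j
  t = m ∸ suc k
  k<m : k < m
  k<m = ≤-trans k<j (m≤n+m j i)

reverseBlock-inside : ∀ {i j k} → i ≤ k → k < j → reverseBlock i j k ≡ mirror i j k
reverseBlock-inside {i} {j} {k} i≤k k<j with position i j k
... | before k<i  = contradiction i≤k (<⇒≱ k<i)
... | inside _ _  = refl
... | after _ j≤k = contradiction j≤k (<⇒≱ k<j)

reverseBlock-outside : ∀ {i j k} → k < i ⊎ j ≤ k → reverseBlock i j k ≡ k
reverseBlock-outside {i} {j} {k} k∉block with position i j k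
... | before _       = refl
... | inside i≤k k<j = contradiction k∉block [ (λ k<i → <⇒≱ k<i i≤k) , <⇒≱ k<j ]
... | after _ _      = refl

reverseBlock-involutive : ∀ i j k → reverseBlock i j (reverseBlock i j k) ≡ k
reverseBlock-involutive i j k with position i j k
... | before k<i     = reverseBlock-outside {i} {j} (inj₁ k<i)
... | inside i≤k k<j =
  trans (reverseBlock-inside (mirror-≥ {i} k<j) (mirror-< i≤k k<j)) (mirror-involutive {i} k<j)
... | after _ j≤k    = reverseBlock-outside {i} {j} (inj₂ j≤k)

reverseBlock-injective : ∀ {i j p q} → p ≢ q → reverseBlock i j p ≢ reverseBlock i j q
reverseBlock-injective {i} {j} {p} {q} p≢q fp≡fq = p≢q (begin
  p                                         ≡⟨ sym (reverseBlock-involutive i j p) ⟩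
  reverseBlock i j (reverseBlock i j p)     ≡⟨ cong (reverseBlock i j) fp≡fq ⟩
  reverseBlock i j (reverseBlock i j q)     ≡⟨ reverseBlock-involutive i j q ⟩
  q                                         ∎)
  where open ≡-Reasoning

reverseBlock-<ᵇ : ∀ {i j p q} → p ≢ q →
  (reverseBlock i j p <ᵇ reverseBlock i j q) ≡ (inBlock i j p ∧ inBlock i j q) xor (p <ᵇ q)
reverseBlock-<ᵇ {i} {j} {p} {q} p≢q with position i j p | position i j q
... | before _       | before _       = refl
... | before p<i     | inside i≤q q<j =
  <ᵇ-both (<-≤-trans p<i (mirror-≥ q<j)) (<-≤-trans p<i i≤q)
... | before _       | after _ _      = refl
... | inside i≤p p<j | before q<i     =
  <ᵇ-neither (<⇒≤ (<-≤-trans q<i (mirror-≥ p<j))) (<⇒≤ (<-≤-trans q<i i≤p))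
... | inside i≤p p<j | after _ j≤q    =
  <ᵇ-both (<-≤-trans (mirror-< i≤p p<j) j≤q) (<-≤-trans p<j j≤q)
... | after _ _      | before _       = refl
... | after _ j≤p    | inside i≤q q<j =
  <ᵇ-neither (≤-trans (<⇒≤ (mirror-< i≤q q<j)) j≤p) (≤-trans (<⇒≤ q<j) j≤p)
... | after _ _      | after _ _      = refl
... | inside _ p<j   | inside _ q<j with <-cmp p q
...   | tri< p<q _ _ =
  trans (<ᵇ-false (<⇒≤ (mirror-reverses {i} p<q q<j))) (cong not (sym (<ᵇ-true p<q)))
...   | tri≈ _ p≡q _ = contradiction p≡q p≢q
...   | tri> _ _ q<p =
  trans (<ᵇ-true (mirror-reverses {i} q<p p<j)) (cong not (sym (<ᵇ-false (<⇒≤ q<p))))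

xorRing : AlmostCommutativeRing _ _
xorRing = fromCommutativeRing xor-∧-commutativeRing (λ _ → nothing)

crossParity-reverseBlock : ∀ {i j a b c d} → a ≢ c → a ≢ d → b ≢ c → b ≢ d →
  let f = reverseBlock i j ; A = inBlock i j a ; B = inBlock i j b
      C = inBlock i j c ; D = inBlock i j d in
  crossParity (f a) (f b) (f c) (f d) ≡ ((A xor B) ∧ (C xor D)) xor crossParity a b c d
crossParity-reverseBlock {i} {j} {a} {b} {c} {d} a≢c a≢d b≢c b≢d
  rewrite reverseBlock-<ᵇ {i} {j} a≢c | reverseBlock-<ᵇ {i} {j} b≢c
        | reverseBlock-<ᵇ {i} {j} a≢d | reverseBlock-<ᵇ {i} {j} b≢d =
  bilinear (inBlock i j a) (inBlock i j b) (inBlock i j c) (inBlock i j d)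
           (a <ᵇ c) (b <ᵇ c) (a <ᵇ d) (b <ᵇ d)
  where
  bilinear : ∀ A B C D w x y z →
    (((A ∧ C) xor w) xor ((B ∧ C) xor x)) xor (((A ∧ D) xor y) xor ((B ∧ D) xor z))
      ≡ ((A xor B) ∧ (C xor D)) xor ((w xor x) xor (y xor z))
  bilinear = solve-∀ xorRing

-- The crossing criterion for chords

Intersects-sorted : ∀ {i j x y} → x < y →
  Intersects (x , suc y) i j ⇔ T (inBlock i j x xor inBlock i j y)
Intersects-sorted {i} {j} {x} {y} x<y with position i j x | position i j y
... | before x<i     | before y<i     =
  mk⇔ (λ { (inj₁ (_ , i≤y , _)) → <⇒≱ y<i (s≤s⁻¹ i≤y) ; (inj₂ (i≤x , _)) → <⇒≱ x<i i≤x }) λ ()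
... | before x<i     | inside i≤y y<j = mk⇔ (const tt) (const (inj₁ (x<i , s≤s i≤y , y<j)))
... | before x<i     | after _ j≤y    =
  mk⇔ (λ { (inj₁ (_ , _ , y<j)) → <⇒≱ y<j j≤y ; (inj₂ (i≤x , _)) → <⇒≱ x<i i≤x }) λ ()
... | inside i≤x _   | before y<i     = contradiction (<-trans x<y y<i) (≤⇒≯ i≤x)
... | inside i≤x _   | inside _ y<j   =
  mk⇔ (λ { (inj₁ (x<i , _)) → <⇒≱ x<i i≤x ; (inj₂ (_ , _ , j≤y)) → <⇒≱ y<j (s≤s⁻¹ j≤y) }) λ ()
... | inside i≤x x<j | after _ j≤y    = mk⇔ (const tt) (const (inj₂ (i≤x , x<j , s≤s j≤y)))
... | after i≤x _    | before y<i     = contradiction (<-trans x<y y<i) (≤⇒≯ i≤x)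
... | after _ j≤x    | inside _ y<j   = contradiction (<-trans x<y y<j) (≤⇒≯ j≤x)
... | after i≤x j≤x  | after _ _      =
  mk⇔ (λ { (inj₁ (x<i , _)) → <⇒≱ x<i i≤x ; (inj₂ (_ , x<j , _)) → <⇒≱ x<j j≤x }) λ ()

Intersects-chord : ∀ {i j x y} → x ≢ y →
  Intersects (chord x y) i j ⇔ T (inBlock i j x xor inBlock i j y)
Intersects-chord {i} {j} {x} {y} x≢y with <-cmp x y
... | tri< x<y _ _ =
  subst (λ e → Intersects e i j ⇔ T (inBlock i j x xor inBlock i j y))
        (sym (chord-≤ (<⇒≤ x<y))) (Intersects-sorted x<y)
... | tri≈ _ x≡y _ = contradiction x≡y x≢y
... | tri> _ _ y<x =
  subst₂ (λ e p → Intersects e i j ⇔ T p) (sym (trans (chord-comm x y) (chord-≤ (<⇒≤ y<x))))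
         (xor-comm (inBlock i j y) _) (Intersects-sorted y<x)

¬⇔-parity : ∀ {P Q : Set} x w → P ⇔ T x → Q ⇔ T (w xor x) → (¬ (P ⇔ Q)) ⇔ T w
¬⇔-parity x     false P⇔x Q⇔x = mk⇔ (λ ¬P⇔Q → ¬P⇔Q (⇔-sym Q⇔x ⇔-∘ P⇔x)) λ ()
¬⇔-parity false true  P⇔⊥ Q⇔⊤ = mk⇔ (const tt) (λ _ P⇔Q → to P⇔⊥ (from P⇔Q (from Q⇔⊤ tt)))
¬⇔-parity true  true  P⇔⊤ Q⇔⊥ = mk⇔ (const tt) (λ _ P⇔Q → to Q⇔⊥ (to P⇔Q (from P⇔⊤ tt)))

CrossingFlipCriterion : ℕ × ℕ → ℕ × ℕ → ℕ × ℕ → ℕ × ℕ → ℕ → ℕ → Set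
CrossingFlipCriterion e₁ e₂ e₁′ e₂′ i j =
  (¬ (Crosses e₁ e₂ ⇔ Crosses e₁′ e₂′)) ⇔ (Intersects e₁ i j × Intersects e₂ i j)

CrossingFlipCriterion-cong : ∀ {e₁ e₂ e₁′ e₂′ x₁ x₂ x₁′ x₂′ i j} →
  e₁ ≡ x₁ → e₂ ≡ x₂ → e₁′ ≡ x₁′ → e₂′ ≡ x₂′ →
  CrossingFlipCriterion x₁ x₂ x₁′ x₂′ i j → CrossingFlipCriterion e₁ e₂ e₁′ e₂′ i j
CrossingFlipCriterion-cong refl refl refl refl criterion = criterion

chord-crossingFlipCriterion : ∀ {i j a b c d} →
  a ≢ b → c ≢ d → a ≢ c → a ≢ d → b ≢ c → b ≢ d →
  let f = reverseBlock i j in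
  CrossingFlipCriterion (chord a b) (chord c d) (chord (f a) (f b)) (chord (f c) (f d)) i j
chord-crossingFlipCriterion {i} {j} {a} {b} {c} {d} a≢b c≢d a≢c a≢d b≢c b≢d = begin
  ¬ (Crosses (chord a b) (chord c d) ⇔ Crosses (chord (f a) (f b)) (chord (f c) (f d)))
    ∼⟨ ¬⇔-parity (crossParity a b c d) (A ∧ B) (crossesByParity a≢b c≢d a≢c a≢d b≢c b≢d)
                 reversedCrossesByParity ⟩
  T (A ∧ B)
    ∼⟨ T-∧ ⟩
  (T A × T B)
    ∼⟨ ⇔-sym (Intersects-chord a≢b) ×-⇔ ⇔-sym (Intersects-chord c≢d) ⟩
  (Intersects (chord a b) i j × Intersects (chord c d) i j) ∎
  where
  open Related.EquationalReasoning
  f : ℕ → ℕ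
  f = reverseBlock i j
  A B : Bool
  A = inBlock i j a xor inBlock i j b
  B = inBlock i j c xor inBlock i j d
  f≢ : ∀ {p q} → p ≢ q → f p ≢ f q
  f≢ = reverseBlock-injective {i} {j}
  reversedCrossesByParity :
    Crosses (chord (f a) (f b)) (chord (f c) (f d)) ⇔ T ((A ∧ B) xor crossParity a b c d)
  reversedCrossesByParity =
    subst (λ p → Crosses (chord (f a) (f b)) (chord (f c) (f d)) ⇔ T p)
          (crossParity-reverseBlock {i} {j} a≢c a≢d b≢c b≢d)
          (crossesByParity (f≢ a≢b) (f≢ c≢d) (f≢ a≢c) (f≢ a≢d) (f≢ b≢c) (f≢ b≢d))

-- Ribbon sides as boundary steps, before and after the reversal

Adjacent : ℕ → ℕ → ℕ → Set
Adjacent x p q = (p ≡ x × q ≡ suc x) ⊎ (p ≡ suc x × q ≡ x)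

Adjacent-⊓ : ∀ {x p q} → Adjacent x p q → p ⊓ q ≡ x
Adjacent-⊓ (inj₁ (refl , refl)) = m≤n⇒m⊓n≡m (n≤1+n _)
Adjacent-⊓ (inj₂ (refl , refl)) = m≥n⇒m⊓n≡n (n≤1+n _)

Adjacent-⊔ : ∀ {x p q} → Adjacent x p q → p ⊔ q ≡ suc x
Adjacent-⊔ (inj₁ (refl , refl)) = m≤n⇒m⊔n≡n (n≤1+n _)
Adjacent-⊔ (inj₂ (refl , refl)) = m≥n⇒m⊔n≡m (n≤1+n _)

-- The side joining sectors s and t occupies boundary step x of the order pos.
AtStep : (ℕ → ℕ) → ℕ × ℕ → ℕ → Set
AtStep pos (s , t) x = Adjacent x (pos s) (pos t)

ends-AtStep : ∀ pos p q {x y} → AtStep pos p x → AtStep pos q y → ends pos (p , q) ≡ chord x y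
ends-AtStep _ _ _ p∼x q∼y =
  cong₂ _,_ (cong₂ _⊓_ (Adjacent-⊓ p∼x) (Adjacent-⊓ q∼y))
            (cong₂ _⊔_ (Adjacent-⊔ p∼x) (Adjacent-⊔ q∼y))

revPos-≤ : ∀ {i j s} → s ≤ i → revPos i j s ≡ s
revPos-≤ s≤i rewrite ≤ᵇ-true s≤i = refl

revPos-≥ : ∀ {i j s} → j ≤ s → revPos i j s ≡ s
revPos-≥ {i} {j} {s} j≤s rewrite ≤ᵇ-true j≤s | ∨-zeroʳ (s ≤ᵇ i) = refl

revPos-inside : ∀ {i j s} → i < s → s < j → revPos i j s ≡ i + j ∸ s
revPos-inside i<s s<j rewrite ≤ᵇ-false i<s | ≤ᵇ-false s<j = refl

AtStep-first : ∀ {i j} → suc i < j → AtStep (revPos i j) (suc i , j) (mirror i j i)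
AtStep-first {i} {j} i+1<j =
  inj₁ (revPos-inside (n<1+n i) i+1<j , trans (revPos-≥ {i} ≤-refl) j≡1+mirror)
  where
  j≡1+mirror : j ≡ suc (mirror i j i)
  j≡1+mirror = trans (sym (m+n∸m≡n i j)) (m∸n≡suc[m∸[1+n]] (m<m+n i (≤-<-trans z≤n i+1<j)))

AtStep-last : ∀ {i k} → i < k → AtStep (revPos i (suc k)) (i , k) (mirror i (suc k) k)
AtStep-last {i} {k} i<k =
  inj₁ ( trans (revPos-≤ ≤-refl) (sym (m+n∸n≡m i (suc k)))
       , trans (revPos-inside i<k (n<1+n k)) (m∸n≡suc[m∸[1+n]] (m≤n+m (suc k) i)))

AtStep-inner : ∀ {i j k} → i < k → suc k < j → AtStep (revPos i j) (k , suc k) (mirror i j k)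
AtStep-inner {i} {j} {k} i<k 1+k<j =
  inj₂ ( trans (revPos-inside i<k k<j) (m∸n≡suc[m∸[1+n]] (≤-trans k<j (m≤n+m j i)))
       , revPos-inside (<-trans i<k (n<1+n k)) 1+k<j)
  where
  k<j : k < j
  k<j = <-trans (n<1+n k) 1+k<j

revStepSectors-AtStep : ∀ {i j} → suc i < j → ∀ k →
  AtStep (revPos i j) (revStepSectors i j k) (reverseBlock i j k)
revStepSectors-AtStep {i} {j} i+1<j k with k ≟ i
... | yes refl rewrite ≡ᵇ-refl k =
  subst (AtStep (revPos k j) (suc k , j))
        (sym (reverseBlock-inside ≤-refl (<-trans (n<1+n k) i+1<j))) (AtStep-first i+1<j)
... | no k≢i rewrite ≡ᵇ-false k≢i with suc k ≟ j
...   | yes refl rewrite ≡ᵇ-refl (suc k) =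
  subst (AtStep (revPos i (suc k)) (i , k))
        (sym (reverseBlock-inside (<⇒≤ i<k) (n<1+n k))) (AtStep-last i<k)
  where
  i<k : i < k
  i<k = s≤s⁻¹ i+1<j
...   | no 1+k≢j rewrite ≡ᵇ-false 1+k≢j with position i j k
...     | before k<i     = inj₁ (revPos-≤ (<⇒≤ k<i) , revPos-≤ k<i)
...     | after _ j≤k    = inj₁ (revPos-≥ {i} j≤k , revPos-≥ {i} (≤-trans j≤k (n≤1+n k)))
...     | inside i≤k k<j = AtStep-inner (≤∧≢⇒< i≤k (≢-sym k≢i)) (≤∧≢⇒< k<j 1+k≢j)

module _ {n} (G : UFatgraph n) where

  sideStep : Fin n → Fin 2 → ℕ
  sideStep r s = toℕ (side G (r , s))

  sideStep-injective : ∀ {r r′ s s′} → sideStep r s ≡ sideStep r′ s′ → (r , s) ≡ (r′ , s′)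
  sideStep-injective = side-inj G ∘ toℕ-injective

  sideSteps-distinct : ∀ r → sideStep r 0F ≢ sideStep r 1F
  sideSteps-distinct r e with sideStep-injective e
  ... | ()

  sideSteps-disjoint : ∀ {r r′} → r ≢ r′ → ∀ s s′ → sideStep r s ≢ sideStep r′ s′
  sideSteps-disjoint r≢r′ s s′ = r≢r′ ∘ cong proj₁ ∘ sideStep-injective

  endsG≡chord : ∀ r → endsG G r ≡ chord (sideStep r 0F) (sideStep r 1F)
  endsG≡chord r =
    ends-AtStep (λ s → s) (stepSectors (sideStep r 0F)) (stepSectors (sideStep r 1F))
                (inj₁ (refl , refl)) (inj₁ (refl , refl))

  endsRev≡chord : ∀ {i j} → suc i < j → ∀ r →
    endsRev G i j r ≡ chord (reverseBlock i j (sideStep r 0F)) (reverseBlock i j (sideStep r 1F))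
  endsRev≡chord {i} {j} i+1<j r =
    ends-AtStep (revPos i j) (revStepSectors i j a) (revStepSectors i j b)
                (revStepSectors-AtStep i+1<j a) (revStepSectors-AtStep i+1<j b)
    where
    a b : ℕ
    a = sideStep r 0F
    b = sideStep r 1F

  ribbons-crossingFlipCriterion : ∀ {i j} → suc i < j → ∀ r₁ r₂ → r₁ ≢ r₂ →
    CrossingFlipCriterion (endsG G r₁) (endsG G r₂) (endsRev G i j r₁) (endsRev G i j r₂) i j
  ribbons-crossingFlipCriterion {i} {j} i+1<j r₁ r₂ r₁≢r₂ =
    CrossingFlipCriterion-cong (endsG≡chord r₁) (endsG≡chord r₂)
                               (endsRev≡chord i+1<j r₁) (endsRev≡chord i+1<j r₂)
      (chord-crossingFlipCriterion {i} {j} (sideSteps-distinct r₁) (sideSteps-distinct r₂)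
         (disjoint 0F 0F) (disjoint 0F 1F) (disjoint 1F 0F) (disjoint 1F 1F))
    where
    disjoint : ∀ s s′ → sideStep r₁ s ≢ sideStep r₂ s′
    disjoint = sideSteps-disjoint r₁≢r₂

lemma3 : ∀ {n} (G : UFatgraph n) (i j : Sector n) → suc (toℕ i) < toℕ j →
         (r₁ r₂ : Fin n) → r₁ ≢ r₂ →
         (¬ (Crosses (endsG G r₁) (endsG G r₂)
              ⇔ Crosses (endsRev G (toℕ i) (toℕ j) r₁) (endsRev G (toℕ i) (toℕ j) r₂)))
         ⇔ (Intersects (endsG G r₁) (toℕ i) (toℕ j) × Intersects (endsG G r₂) (toℕ i) (toℕ j))
lemma3 G i j = ribbons-crossingFlipCriterion G
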